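{- The RL-XBWT of a trie $\mathcal T$ can be stored in $O(r)$ machine words of $\Theta(\log n)$ bits, where $r$ is the number of XBWT runs of $\mathcal T$.
   Context: A trie is a rooted tree with $n$ nodes whose edges are labeled with characters of $\Sigma=\{1,\dots,\sigma\}$, totally ordered by $\prec$, such that the edges leaving any node carry pairwise distinct labels. $\lambda(\hat u)$ is the label of the edge entering $\hat u$; for the root it is $\#$, the $\prec$-smallest character, which labels no edge; every character of $\Sigma$ is $\lambda(\hat u)$ for some node. $out(\hat u)$ is the set of labels of edges leaving $\hat u$. Nodes are sorted co-lexicographically: $\hat u<\hat v$ iff the root-to-node label string of $\hat u$ precedes that of $\hat v$ when compared right-to-left with $\prec$; let $\hat u_1<\dots<\hat u_n$ be the sorted nodes. For $c\in\Sigma$ and $1\le i\le n$, $i$ is a $c$-run break if $c\in out(\hat u_i)$ and either $i=n$ or $c\notin out(\hat u_{i+1})$; $r$ is the total number of pairs $(i,c)$ with $i$ a $c$-run break. RL-XBWT: partition $\hat u_1,\dots,\hat u_n$ into maximal contiguous blocks of nodes all having the same set $out(\cdot)$; say there are $r'$ blocks and block $q$ starts at $\hat u_{i_q}$ and has $\ell_q$ nodes. With $out(\hat u_0)=\emptyset$, let $ADD_q=out(\hat u_{i_q})\setminus out(\hat u_{i_q-1})$ and $DEL_q=out(\hat u_{i_q-1})\setminus out(\hat u_{i_q})$. The RL-XBWT is the sequence of triples $(ADD_q,DEL_q,\ell_q)_{q=1}^{r'}$. -}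

module Defs where

open import Data.Nat using (ℕ; zero; suc; _+_; _*_; _≤_; _<_)
open import Data.Fin as Fin using (Fin; toℕ)
open import Data.List using (List; []; _∷_; _∷ʳ_; length; filter; map; reverse; concatMap; _++_; allFin)
open import Data.List.Properties using (≡-dec)
open import Data.List.Membership.Propositional using (_∈_)
import Data.List.Membership.DecPropositional as DecMem
open import Data.List.Relation.Unary.Linked using (Linked)
open import Data.Product using (_×_; _,_; ∃-syntax)
open import Relation.Nullary using (¬?)
open import Relation.Binary.PropositionalEquality using (_≡_)

Word : ℕ → Set
Word σ = List (Fin σ)

_∈c?_ : ∀ {σ} (c : Fin σ) (xs : List (Fin σ)) → _
_∈c?_ = DecMem._∈?_ Fin._≟_

_∈w?_ : ∀ {σ} (w : Word σ) (ws : List (Word σ)) → _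
_∈w?_ = DecMem._∈?_ (≡-dec Fin._≟_)

data LexLT {σ : ℕ} : Word σ → Word σ → Set where
  []<∷  : ∀ {c w} → LexLT [] (c ∷ w)
  here  : ∀ {c d w w'} → toℕ c < toℕ d → LexLT (c ∷ w) (d ∷ w')
  there : ∀ {c w w'} → LexLT w w' → LexLT (c ∷ w) (c ∷ w')

ColexLT : ∀ {σ} → Word σ → Word σ → Set
ColexLT u v = LexLT (reverse u) (reverse v)

-- A trie with edge labels in Σ = Fin σ, represented by the list of the
-- root-to-node label strings of its nodes, listed in co-lexicographic order
-- (so the list is û₁ < ... < ûₙ and n = length N).
record IsTrie (σ : ℕ) (N : List (Word σ)) : Set where
  field
    sorted       : Linked ColexLT N
    hasRoot      : [] ∈ N
    prefixClosed : ∀ w c → (w ∷ʳ c) ∈ N → w ∈ N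
    allLabels    : ∀ (c : Fin σ) → ∃[ w ] ((w ∷ʳ c) ∈ N)

out : ∀ {σ} → List (Word σ) → Word σ → List (Fin σ)
out N w = filter (λ c → (w ∷ʳ c) ∈w? N) (allFin _)

_∖_ : ∀ {σ} → List (Fin σ) → List (Fin σ) → List (Fin σ)
A ∖ B = filter (λ c → ¬? (c ∈c? B)) A

-- r: number of pairs (i, c) with i a c-run break, over the sorted node list
breaksFrom : ∀ {σ} → List (Word σ) → List (Word σ) → ℕ
breaksFrom N []           = 0
breaksFrom N (u ∷ [])     = length (out N u)
breaksFrom N (u ∷ v ∷ us) = length (out N u ∖ out N v) + breaksFrom N (v ∷ us)

runs : ∀ {σ} → List (Word σ) → ℕ
runs N = breaksFrom N N

rle : ∀ {σ} → List (List (Fin σ)) → List (List (Fin σ) × ℕ)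
rle [] = []
rle (x ∷ xs) with rle xs
... | [] = (x , 1) ∷ []
... | (y , k) ∷ rest with ≡-dec Fin._≟_ x y
...   | Relation.Nullary.yes _ = (y , suc k) ∷ rest
...   | Relation.Nullary.no  _ = (x , 1) ∷ (y , k) ∷ rest

Triple : ℕ → Set
Triple σ = List (Fin σ) × List (Fin σ) × ℕ

-- triples (ADD_q, DEL_q, ℓ_q) given the out-set of the previous node
triples : ∀ {σ} → List (Fin σ) → List (List (Fin σ) × ℕ) → List (Triple σ)
triples prev [] = []
triples prev ((S , ℓ) ∷ rest) = (S ∖ prev , prev ∖ S , ℓ) ∷ triples S rest

-- the RL-XBWT of the trie, with out(û₀) = ∅
RLXBWT : ∀ {σ} → List (Word σ) → List (Triple σ)
RLXBWT N = triples [] (rle (map (out N) N))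

-- storage as a sequence of machine words (natural numbers):
-- each triple is stored as |ADD|, |DEL|, ℓ, followed by the characters of ADD and DEL
encodeTriple : ∀ {σ} → Triple σ → List ℕ
encodeTriple (A , D , ℓ) = length A ∷ length D ∷ ℓ ∷ (map toℕ A ++ map toℕ D)

encode : ∀ {σ} → List (Triple σ) → List ℕ
encode = concatMap encodeTriple

-- Storing the q-th triple takes 3 + |ADD_q| + |DEL_q| words. A character added at a block starts
-- one of its runs and runs start as often as they end, so Σ|ADD_q| = r; a deleted character ends
-- a run at the node before, so Σ|DEL_q| ≤ r; consecutive blocks have different out-sets, so every
-- block but the first adds or deletes something. Altogether at most 3 + 8r words are used, each a
-- set size or a block length (≤ n) or a character (< σ ≤ n, as every character labels an edge).
module Submission where

open import Defs
open import Data.Nat using (ℕ; _+_; _*_; _≤_)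
open import Data.Fin using (Fin)
open import Data.List using (List; length)
open import Data.List.Relation.Unary.All using (All)
open import Data.Product using (_×_; ∃-syntax)

open import Function using (_∘_)
open import Data.Nat using (suc; z≤n; s≤s)
open import Data.Nat.Properties
open import Data.Nat.Tactic.RingSolver using (solve-∀)
open import Algebra.Properties.CommutativeSemigroup +-commutativeSemigroup using (interchange; xy∙z≈xz∙y)
import Data.Fin as Fin
open import Data.Fin using (toℕ)
open import Data.Fin.Properties using (injective⇒≤; toℕ<n)
open import Data.List using ([]; _∷_; _∷ʳ_; filter; map; _++_; allFin; lookup)
open import Data.List.Properties
  using (length-filter; length-++; length-map; length-tabulate; filter-≐; filter-none; ∷ʳ-injectiveʳ; ≡-dec)
open import Data.List.Membership.Propositional using (_∈_)
open import Data.List.Membership.Propositional.Properties using (∈-filter⁺; ∈-filter⁻; ∈-allFin; ∉[])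
open import Data.List.Relation.Unary.All using ([]; _∷_)
import Data.List.Relation.Unary.All as All
open import Data.List.Relation.Unary.All.Properties using (++⁺; map⁺)
open import Data.List.Relation.Unary.Linked using (Linked; []; [-]; _∷_)
open import Data.List.Relation.Unary.Any using (index)
open import Data.List.Relation.Unary.Any.Properties using (lookup-index)
open import Data.Product using (_,_; proj₁; proj₂; swap)
open import Relation.Nullary using (yes; no; ¬?; _×-dec_; contradiction)
open import Relation.Nullary.Decidable using (decidable-stable)
open import Relation.Unary using (Pred; Decidable)
open import Relation.Binary.PropositionalEquality

module _ {a p} {A : Set a} {P : Pred A p} (P? : Decidable P) where

  length-filter-¬+length-filter : ∀ xs →
    length (filter (λ x → ¬? (P? x)) xs) + length (filter P? xs) ≡ length xs
  length-filter-¬+length-filter [] = refl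
  length-filter-¬+length-filter (x ∷ xs) with P? x
  ... | yes _ = trans (+-suc _ _) (cong suc (length-filter-¬+length-filter xs))
  ... | no  _ = cong suc (length-filter-¬+length-filter xs)

  filter-filter : ∀ {q} {Q : Pred A q} (Q? : Decidable Q) xs →
    filter Q? (filter P? xs) ≡ filter (λ x → P? x ×-dec Q? x) xs
  filter-filter Q? [] = refl
  filter-filter Q? (x ∷ xs) with P? x
  ... | no  _ = filter-filter Q? xs
  ... | yes _ with Q? x
  ...   | yes _ = cong (x ∷_) (filter-filter Q? xs)
  ...   | no  _ = filter-filter Q? xs

filter-comm : ∀ {a p q} {A : Set a} {P : Pred A p} {Q : Pred A q} (P? : Decidable P) (Q? : Decidable Q) xs →
  filter Q? (filter P? xs) ≡ filter P? (filter Q? xs)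
filter-comm P? Q? xs = begin
  filter Q? (filter P? xs)                ≡⟨ filter-filter P? Q? xs ⟩
  filter (λ x → P? x ×-dec Q? x) xs       ≡⟨ filter-≐ _ _ (swap , swap) xs ⟩
  filter (λ x → Q? x ×-dec P? x) xs       ≡⟨ filter-filter Q? P? xs ⟨
  filter P? (filter Q? xs)                ∎
  where open ≡-Reasoning

3*b+c≤8*r+8 : ∀ {b c r} → b ≤ 1 + c → c ≤ r + r → 3 * b + c ≤ 8 * r + 8
3*b+c≤8*r+8 {b} {c} {r} b≤ c≤ = begin
  3 * b + c             ≤⟨ +-monoˡ-≤ c (*-monoʳ-≤ 3 b≤) ⟩
  3 * (1 + c) + c       ≡⟨ expand c ⟩
  3 + 4 * c             ≤⟨ +-monoʳ-≤ 3 (*-monoʳ-≤ 4 c≤) ⟩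
  3 + 4 * (r + r)       ≡⟨ collect r ⟩
  8 * r + 3             ≤⟨ +-monoʳ-≤ (8 * r) (s≤s (s≤s (s≤s z≤n))) ⟩
  8 * r + 8             ∎
  where
  open ≤-Reasoning
  expand : ∀ c → 3 * (1 + c) + c ≡ 3 + 4 * c
  expand = solve-∀
  collect : ∀ r → 3 + 4 * (r + r) ≡ 8 * r + 3
  collect = solve-∀

module _ {σ : ℕ} where

  -- A subset of Σ listed without repetition in increasing order, as out lists it; set sizes are then lengths.
  Canonical : List (Fin σ) → Set
  Canonical x = x ≡ filter (_∈c? x) (allFin σ)

  canonical-length≤ : ∀ {x} → Canonical x → length x ≤ σ
  canonical-length≤ {x} x≡ = begin
    length x                              ≡⟨ cong length x≡ ⟩
    length (filter (_∈c? x) (allFin σ))   ≤⟨ length-filter (_∈c? x) (allFin σ) ⟩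
    length (allFin σ)                     ≡⟨ length-tabulate (λ c → c) ⟩
    σ                                     ∎
    where open ≤-Reasoning

  length-∩-comm : ∀ {x y} → Canonical x → Canonical y →
    length (filter (_∈c? y) x) ≡ length (filter (_∈c? x) y)
  length-∩-comm {x} {y} x≡ y≡ = cong length (begin
    filter (_∈c? y) x                            ≡⟨ cong (filter (_∈c? y)) x≡ ⟩
    filter (_∈c? y) (filter (_∈c? x) (allFin σ)) ≡⟨ filter-comm (_∈c? x) (_∈c? y) (allFin σ) ⟩
    filter (_∈c? x) (filter (_∈c? y) (allFin σ)) ≡⟨ cong (filter (_∈c? x)) y≡ ⟨
    filter (_∈c? x) y                            ∎)
    where open ≡-Reasoning

  ∖≡[]⇒⊆ : ∀ {x y : List (Fin σ)} → x ∖ y ≡ [] → ∀ {c} → c ∈ x → c ∈ y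
  ∖≡[]⇒⊆ {x} {y} x∖y≡[] {c} c∈x = decidable-stable (c ∈c? y) λ c∉y →
    ∉[] (subst (c ∈_) x∖y≡[] (∈-filter⁺ (λ d → ¬? (d ∈c? y)) c∈x c∉y))

  canonical-∖-[]⇒≡ : ∀ {x y} → Canonical x → Canonical y → x ∖ y ≡ [] → y ∖ x ≡ [] → x ≡ y
  canonical-∖-[]⇒≡ {x} {y} x≡ y≡ x∖y≡[] y∖x≡[] =
    trans x≡ (trans (filter-≐ (_∈c? x) (_∈c? y) (∖≡[]⇒⊆ x∖y≡[] , ∖≡[]⇒⊆ y∖x≡[]) (allFin σ)) (sym y≡))

  canonical-≢⇒1≤∣∖∣+∣∖∣ : ∀ {x y} → Canonical x → Canonical y → x ≢ y →
    1 ≤ length (y ∖ x) + length (x ∖ y)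
  canonical-≢⇒1≤∣∖∣+∣∖∣ {x} {y} x≡ y≡ x≢y with y ∖ x in y∖x≡ | x ∖ y in x∖y≡
  ... | _ ∷ _ | _     = s≤s z≤n
  ... | []    | _ ∷ _ = s≤s z≤n
  ... | []    | []    = contradiction (canonical-∖-[]⇒≡ x≡ y≡ x∖y≡ y∖x≡) x≢y

  ∖-self : ∀ (x : List (Fin σ)) → x ∖ x ≡ []
  ∖-self x = filter-none (λ c → ¬? (c ∈c? x)) {xs = x} (All.tabulate λ c∈x c∉x → c∉x c∈x)

  ∩-[] : ∀ (x : List (Fin σ)) → filter (_∈c? []) x ≡ []
  ∩-[] x = filter-none (_∈c? []) {xs = x} (All.tabulate λ _ ())

  runBreaks : List (List (Fin σ)) → ℕ
  runBreaks []          = 0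
  runBreaks (x ∷ [])    = length x
  runBreaks (x ∷ y ∷ D) = length (x ∖ y) + runBreaks (y ∷ D)

  adds dels : List (Fin σ) → List (List (Fin σ)) → ℕ
  adds P []      = 0
  adds P (S ∷ D) = length (S ∖ P) + adds S D
  dels P []      = 0
  dels P (S ∷ D) = length (P ∖ S) + dels S D

  runBreaks-[]∷ : ∀ D → runBreaks ([] ∷ D) ≡ runBreaks D
  runBreaks-[]∷ []      = refl
  runBreaks-[]∷ (_ ∷ _) = refl

  -- Every c ∈ x lies either in x ∖ P (a run of c starts at x) or in x ∩ P; and run starts match run ends.
  adds+∣∩∣≡runBreaks : ∀ P x D → All Canonical (x ∷ D) →
    adds P (x ∷ D) + length (filter (_∈c? P) x) ≡ runBreaks (x ∷ D)
  adds+∣∩∣≡runBreaks P x [] _ = begin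
    (length (x ∖ P) + 0) + length (filter (_∈c? P) x) ≡⟨ cong (_+ length (filter (_∈c? P) x)) (+-identityʳ (length (x ∖ P))) ⟩
    length (x ∖ P) + length (filter (_∈c? P) x)       ≡⟨ length-filter-¬+length-filter (_∈c? P) x ⟩
    length x                                          ∎
    where open ≡-Reasoning
  adds+∣∩∣≡runBreaks P x (y ∷ D) (x≡ ∷ cs@(y≡ ∷ _)) = begin
    (length (x ∖ P) + adds x (y ∷ D)) + length (filter (_∈c? P) x)
      ≡⟨ xy∙z≈xz∙y (length (x ∖ P)) (adds x (y ∷ D)) (length (filter (_∈c? P) x)) ⟩
    (length (x ∖ P) + length (filter (_∈c? P) x)) + adds x (y ∷ D)
      ≡⟨ cong (_+ adds x (y ∷ D)) (length-filter-¬+length-filter (_∈c? P) x) ⟩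
    length x + adds x (y ∷ D)
      ≡⟨ cong (_+ adds x (y ∷ D)) (length-filter-¬+length-filter (_∈c? y) x) ⟨
    (length (x ∖ y) + length (filter (_∈c? y) x)) + adds x (y ∷ D)
      ≡⟨ cong (λ k → (length (x ∖ y) + k) + adds x (y ∷ D)) (length-∩-comm x≡ y≡) ⟩
    (length (x ∖ y) + length (filter (_∈c? x) y)) + adds x (y ∷ D)
      ≡⟨ +-assoc (length (x ∖ y)) _ _ ⟩
    length (x ∖ y) + (length (filter (_∈c? x) y) + adds x (y ∷ D))
      ≡⟨ cong (length (x ∖ y) +_) (trans (+-comm (length (filter (_∈c? x) y)) (adds x (y ∷ D))) (adds+∣∩∣≡runBreaks x y D cs)) ⟩
    length (x ∖ y) + runBreaks (y ∷ D)
      ∎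
    where open ≡-Reasoning

  adds[]≡runBreaks : ∀ D → All Canonical D → adds [] D ≡ runBreaks D
  adds[]≡runBreaks []      _  = refl
  adds[]≡runBreaks (x ∷ D) cs = begin
    adds [] (x ∷ D)                                    ≡⟨ +-identityʳ _ ⟨
    adds [] (x ∷ D) + 0                                ≡⟨ cong (λ l → adds [] (x ∷ D) + length l) (∩-[] x) ⟨
    adds [] (x ∷ D) + length (filter (_∈c? []) x)      ≡⟨ adds+∣∩∣≡runBreaks [] x D cs ⟩
    runBreaks (x ∷ D)                                  ∎
    where open ≡-Reasoning

  dels≤runBreaks : ∀ P D → dels P D ≤ runBreaks (P ∷ D)
  dels≤runBreaks P []      = z≤n
  dels≤runBreaks P (S ∷ D) = +-monoʳ-≤ (length (P ∖ S)) (dels≤runBreaks S D)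

  dels[]≤runBreaks : ∀ D → dels [] D ≤ runBreaks D
  dels[]≤runBreaks D = ≤-trans (dels≤runBreaks [] D) (≤-reflexive (runBreaks-[]∷ D))

  length≤adds+dels : ∀ S D → All Canonical (S ∷ D) → Linked _≢_ (S ∷ D) →
    length D ≤ adds S D + dels S D
  length≤adds+dels S []      _                 _            = z≤n
  length≤adds+dels S (T ∷ D) (S≡ ∷ cs@(T≡ ∷ _)) (S≢T ∷ lk) = begin
    1 + length D
      ≤⟨ +-mono-≤ (canonical-≢⇒1≤∣∖∣+∣∖∣ S≡ T≡ S≢T) (length≤adds+dels T D cs lk) ⟩
    (length (T ∖ S) + length (S ∖ T)) + (adds T D + dels T D)
      ≡⟨ interchange (length (T ∖ S)) (length (S ∖ T)) (adds T D) (dels T D) ⟩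
    adds S (T ∷ D) + dels S (T ∷ D)
      ∎
    where open ≤-Reasoning

  length≤1+adds[]+dels[] : ∀ D → All Canonical D → Linked _≢_ D →
    length D ≤ 1 + (adds [] D + dels [] D)
  length≤1+adds[]+dels[] []      _  _  = z≤n
  length≤1+adds[]+dels[] (S ∷ D) cs lk =
    s≤s (≤-trans (length≤adds+dels S D cs lk) (+-mono-≤ (m≤n+m (adds S D) (length (S ∖ []))) (m≤n+m (dels S D) (length ([] ∖ S)))))

  rle-All : ∀ {q} {Q : Pred (List (Fin σ)) q} {xs} → All Q xs → All (Q ∘ proj₁) (rle xs)
  rle-All {xs = []}     []        = []
  rle-All {xs = x ∷ xs} (qx ∷ qs) with rle xs | rle-All qs
  ... | []             | _           = qx ∷ []
  ... | (y , k) ∷ rest | qy ∷ qrest with ≡-dec Fin._≟_ x y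
  ...   | yes _ = qy ∷ qrest
  ...   | no  _ = qx ∷ qy ∷ qrest

  rle-lengths≤ : ∀ (xs : List (List (Fin σ))) → All (λ b → proj₂ b ≤ length xs) (rle xs)
  rle-lengths≤ []       = []
  rle-lengths≤ (x ∷ xs) with rle xs | rle-lengths≤ xs
  ... | []             | _           = s≤s z≤n ∷ []
  ... | (y , k) ∷ rest | k≤ ∷ rest≤ with ≡-dec Fin._≟_ x y
  ...   | yes _ = s≤s k≤ ∷ All.map m≤n⇒m≤1+n rest≤
  ...   | no  _ = s≤s z≤n ∷ m≤n⇒m≤1+n k≤ ∷ All.map m≤n⇒m≤1+n rest≤

  rle-distinct : ∀ (xs : List (List (Fin σ))) → Linked _≢_ (map proj₁ (rle xs))
  rle-distinct []       = []
  rle-distinct (x ∷ xs) with rle xs | rle-distinct xs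
  ... | []             | _  = [-]
  ... | (y , k) ∷ rest | lk with ≡-dec Fin._≟_ x y
  ...   | yes _   = lk
  ...   | no  x≢y = x≢y ∷ lk

  runBreaks-∷-rle : ∀ z xs → runBreaks (z ∷ map proj₁ (rle xs)) ≡ runBreaks (z ∷ xs)
  runBreaks-∷-rle z []       = refl
  runBreaks-∷-rle z (x ∷ xs) with rle xs | runBreaks-∷-rle x xs
  ... | []             | ih = cong (length (z ∖ x) +_) ih
  ... | (y , k) ∷ rest | ih with ≡-dec Fin._≟_ x y
  ...   | yes refl = cong (length (z ∖ x) +_)
                       (trans (cong (λ l → length l + runBreaks (x ∷ map proj₁ rest)) (sym (∖-self x))) ih)
  ...   | no  _    = cong (length (z ∖ x) +_) ih

  runBreaks-rle : ∀ xs → runBreaks (map proj₁ (rle xs)) ≡ runBreaks xs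
  runBreaks-rle xs = begin
    runBreaks (map proj₁ (rle xs))       ≡⟨ runBreaks-[]∷ (map proj₁ (rle xs)) ⟨
    runBreaks ([] ∷ map proj₁ (rle xs))  ≡⟨ runBreaks-∷-rle [] xs ⟩
    runBreaks ([] ∷ xs)                  ≡⟨ runBreaks-[]∷ xs ⟩
    runBreaks xs                         ∎
    where open ≡-Reasoning

  length-encodeTriple : ∀ (t : Triple σ) → let (A , D , _) = t in
    length (encodeTriple t) ≡ 3 + (length A + length D)
  length-encodeTriple (A , D , _) = cong (3 +_) (begin
    length (map toℕ A ++ map toℕ D)          ≡⟨ length-++ (map toℕ A) ⟩
    length (map toℕ A) + length (map toℕ D)  ≡⟨ cong₂ _+_ (length-map toℕ A) (length-map toℕ D) ⟩
    length A + length D                      ∎)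
    where open ≡-Reasoning

  length-encode-triples : ∀ P B →
    length (encode (triples P B)) ≡ 3 * length B + (adds P (map proj₁ B) + dels P (map proj₁ B))
  length-encode-triples P []            = refl
  length-encode-triples P ((S , ℓ) ∷ B) = begin
    length (encodeTriple (S ∖ P , P ∖ S , ℓ) ++ encode (triples S B))
      ≡⟨ length-++ (encodeTriple (S ∖ P , P ∖ S , ℓ)) ⟩
    length (encodeTriple (S ∖ P , P ∖ S , ℓ)) + length (encode (triples S B))
      ≡⟨ cong₂ _+_ (length-encodeTriple (S ∖ P , P ∖ S , ℓ)) (length-encode-triples S B) ⟩
    (3 + (length (S ∖ P) + length (P ∖ S))) + (3 * length B + (adds S (map proj₁ B) + dels S (map proj₁ B)))
      ≡⟨ regroup (length (S ∖ P)) (length (P ∖ S)) (length B) (adds S (map proj₁ B)) (dels S (map proj₁ B)) ⟩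
    3 * suc (length B) + ((length (S ∖ P) + adds S (map proj₁ B)) + (length (P ∖ S) + dels S (map proj₁ B)))
      ∎
    where
    open ≡-Reasoning
    regroup : ∀ a d b A D → (3 + (a + d)) + (3 * b + (A + D)) ≡ 3 * suc b + ((a + A) + (d + D))
    regroup = solve-∀

  encode-triples-≤ : ∀ {n} → σ ≤ n → ∀ {P} → length P ≤ n → ∀ B →
    All ((_≤ n) ∘ length ∘ proj₁) B → All ((_≤ n) ∘ proj₂) B → All (_≤ n) (encode (triples P B))
  encode-triples-≤ σ≤n P≤ [] [] [] = []
  encode-triples-≤ {n} σ≤n {P} P≤ ((S , ℓ) ∷ B) (S≤ ∷ Ss≤) (ℓ≤ ∷ ℓs≤) =
    ++⁺ (≤-trans (length-filter (λ c → ¬? (c ∈c? P)) S) S≤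
          ∷ ≤-trans (length-filter (λ c → ¬? (c ∈c? S)) P) P≤
          ∷ ℓ≤
          ∷ ++⁺ (characters≤ (S ∖ P)) (characters≤ (P ∖ S)))
        (encode-triples-≤ σ≤n S≤ B Ss≤ ℓs≤)
    where
    characters≤ : ∀ xs → All (_≤ n) (map toℕ xs)
    characters≤ xs = map⁺ (All.universal (λ c → ≤-trans (<⇒≤ (toℕ<n c)) σ≤n) xs)

  breaksFrom≡runBreaks : ∀ (N us : List (Word σ)) → breaksFrom N us ≡ runBreaks (map (out N) us)
  breaksFrom≡runBreaks N []           = refl
  breaksFrom≡runBreaks N (u ∷ [])     = refl
  breaksFrom≡runBreaks N (u ∷ v ∷ us) = cong (length (out N u ∖ out N v) +_) (breaksFrom≡runBreaks N (v ∷ us))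

  out-canonical : ∀ (N : List (Word σ)) w → Canonical (out N w)
  out-canonical N w = filter-≐ (λ c → (w ∷ʳ c) ∈w? N) (_∈c? out N w) (to , from) (allFin σ)
    where
    to : ∀ {c} → (w ∷ʳ c) ∈ N → c ∈ out N w
    to {c} = ∈-filter⁺ (λ c → (w ∷ʳ c) ∈w? N) (∈-allFin c)
    from : ∀ {c} → c ∈ out N w → (w ∷ʳ c) ∈ N
    from = proj₂ ∘ ∈-filter⁻ (λ c → (w ∷ʳ c) ∈w? N) {xs = allFin σ}

  σ≤length : ∀ {N} → IsTrie σ N → σ ≤ length N
  σ≤length {N} trie = injective⇒≤ {f = node} node-injective
    where
    open IsTrie trie
    node : Fin σ → Fin (length N)
    node c = index (proj₂ (allLabels c))
    node-injective : ∀ {c d} → node c ≡ node d → c ≡ d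
    node-injective {c} {d} eq = ∷ʳ-injectiveʳ (proj₁ (allLabels c)) (proj₁ (allLabels d))
      (trans (lookup-index (proj₂ (allLabels c)))
        (trans (cong (lookup N) eq) (sym (lookup-index (proj₂ (allLabels d))))))

  length-encode-RLXBWT≤ : ∀ (N : List (Word σ)) → length (encode (RLXBWT N)) ≤ 8 * runs N + 8
  length-encode-RLXBWT≤ N = begin
    length (encode (RLXBWT N))                            ≡⟨ length-encode-triples [] blocks ⟩
    3 * length blocks + (adds [] sets + dels [] sets)     ≤⟨ 3*b+c≤8*r+8 {r = runs N} blocks≤ (+-mono-≤ adds≤ dels≤) ⟩
    8 * runs N + 8                                        ∎
    where
    open ≤-Reasoning
    blocks : List (List (Fin σ) × ℕ)
    blocks = rle (map (out N) N)
    sets : List (List (Fin σ))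
    sets = map proj₁ blocks
    sets-canonical : All Canonical sets
    sets-canonical = map⁺ (rle-All (map⁺ (All.universal (out-canonical N) N)))
    runBreaks-sets : runBreaks sets ≡ runs N
    runBreaks-sets = trans (runBreaks-rle (map (out N) N)) (sym (breaksFrom≡runBreaks N N))
    adds≤ : adds [] sets ≤ runs N
    adds≤ = ≤-reflexive (trans (adds[]≡runBreaks sets sets-canonical) runBreaks-sets)
    dels≤ : dels [] sets ≤ runs N
    dels≤ = subst (dels [] sets ≤_) runBreaks-sets (dels[]≤runBreaks sets)
    blocks≤ : length blocks ≤ 1 + (adds [] sets + dels [] sets)
    blocks≤ = subst (_≤ 1 + (adds [] sets + dels [] sets)) (length-map proj₁ blocks)
      (length≤1+adds[]+dels[] sets sets-canonical (rle-distinct (map (out N) N)))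

  encode-RLXBWT-≤length : ∀ {N : List (Word σ)} → IsTrie σ N → All (_≤ length N) (encode (RLXBWT N))
  encode-RLXBWT-≤length {N} trie = encode-triples-≤ (σ≤length trie) z≤n (rle outs)
    (rle-All (map⁺ (All.universal (λ w → ≤-trans (canonical-length≤ (out-canonical N w)) (σ≤length trie)) N)))
    (subst (λ m → All ((_≤ m) ∘ proj₂) (rle outs)) (length-map (out N) N) (rle-lengths≤ outs))
    where
    outs : List (List (Fin σ))
    outs = map (out N) N

lemma1 : ∃[ C ] (∀ (σ : ℕ) (N : List (Word σ)) → IsTrie σ N →
    (length (encode (RLXBWT N)) ≤ C * runs N + C)
    × All (λ x → x ≤ length N) (encode (RLXBWT N)))
lemma1 = 8 , λ _ N trie → length-encode-RLXBWT≤ N , encode-RLXBWT-≤length trie
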